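{- Let $n\ge1$, let $\alpha_1,\alpha_2,\dots$ be nonzero complex numbers, and let $\lambda,\mu$ be partitions with at most $n$ parts. Write $Z(\mathfrak{S}^{\Gamma'}_{\lambda,\infty}(-\alpha_\mu\mid\alpha))$ for the partition function of the system described in the context, evaluated at $z_i=-\alpha_{\mu_i+n+1-i}$ ($1\le i\le n$). Then $Z(\mathfrak{S}^{\Gamma'}_{\lambda,\infty}(-\alpha_\mu\mid\alpha))=0$ unless $\lambda\subset\mu$, and \[Z(\mathfrak{S}^{\Gamma'}_{\lambda,\infty}(-\alpha_\lambda\mid\alpha))=\prod_{(i,j)\in\lambda}\left(\frac{\alpha_{n+1-i+\lambda_i}}{\alpha_{n-\lambda'_j+j}}-1\right).\]
   Context: $\lambda\subset\mu$ means $\lambda_i\le\mu_i$ for all $i$; $\lambda'$ is the conjugate partition; the product is over boxes $(i,j)$ of the Young diagram of $\lambda$. The system $\mathfrak{S}^{\Gamma'}_{\lambda,\infty}(z\mid\alpha)$: a grid with $n$ rows numbered $1,\dots,n$ top to bottom and $N=n+\lambda_1$ columns numbered $1,\dots,N$ right to left; vertex $(i,j)$ in row $i$, column $j$; each vertex has left, top, right, bottom edges, shared between neighbours, with boundary edges at the ends of each row and column. A state assigns $\pm$ to every edge with left and bottom boundary edges $+$, right boundary edges $-$, top boundary edge of column $j$ equal to $-$ iff $j=\lambda_k+n-k+1$ for some $k$. The weight of vertex $(i,j)$ for spins (left, top, right, bottom) is: $(+,+,+,+)$: $1$; $(-,-,-,-)$: $1$; $(+,-,+,-)$: $1$; $(-,+,-,+)$: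 $-z_i/\alpha_j-1$; $(-,+,+,-)$: $-z_i/\alpha_j$; $(+,-,-,+)$: $1$; otherwise $0$. A state's weight is the product of vertex weights; the partition function is the sum over all states. -}

module Defs where

open import Level using (Level; _⊔_) renaming (suc to lsuc)
open import Algebra.Bundles using (CommutativeRing)
open import Data.Bool using (Bool; true; false; _∧_; if_then_else_)
open import Data.Bool.Properties using () renaming (_≟_ to _≟ᵇ_)
open import Data.Nat using (ℕ; zero; suc; _+_; _∸_; _≤_; _≤ᵇ_; _≟_)
open import Data.Fin using (Fin; toℕ; fromℕ; inject₁)
open import Data.Fin.Properties using (any?)
open import Data.Vec using (Vec; []; _∷_; lookup)
open import Data.List using (List; []; _∷_; [_]; map; concatMap; filter; foldr; cartesianProduct)
open import Data.Product using (_×_; _,_; proj₁; proj₂)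
open import Relation.Nullary using (¬_; Dec; yes; no)
open import Relation.Nullary.Decidable using (⌊_⌋)
open import Relation.Binary.PropositionalEquality using (_≡_)

-- A field (stdlib has none): a commutative ring with a (total) inverse
-- map that is a genuine inverse on nonzero elements, and 1 ≠ 0.
-- (The value of 0⁻¹ is irrelevant; it is never used below since all
-- divisions are by the nonzero α's.)

record Field c ℓ : Set (lsuc (c ⊔ ℓ)) where
  field
    commutativeRing : CommutativeRing c ℓ
  open CommutativeRing commutativeRing public
  field
    _⁻¹        : Carrier → Carrier
    1≉0        : ¬ (1# ≈ 0#)
    ⁻¹-inverse : ∀ x → ¬ (x ≈ 0#) → x * (x ⁻¹) ≈ 1#

-- Partitions with at most n parts: weakly decreasing vectors of length n
-- (padded with zeros).

IsPartition : ∀ {n} → Vec ℕ n → Set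
IsPartition {n} la = ∀ (i j : Fin n) → toℕ i ≤ toℕ j → lookup la j ≤ lookup la i

_⊆ₚ_ : ∀ {n} → Vec ℕ n → Vec ℕ n → Set
_⊆ₚ_ {n} la mu = ∀ (i : Fin n) → lookup la i ≤ lookup mu i

-- λ_1 (0 for the empty vector; n ≥ 1 in the theorem)
first : ∀ {n} → Vec ℕ n → ℕ
first []      = 0
first (x ∷ _) = x

allF : (n : ℕ) → (Fin n → Bool) → Bool
allF zero    f = true
allF (suc n) f = f Data.Fin.zero ∧ allF n (λ k → f (Data.Fin.suc k))

countF : (n : ℕ) → (Fin n → Bool) → ℕ
countF zero    f = 0
countF (suc n) f = (if f Data.Fin.zero then 1 else 0) + countF n (λ k → f (Data.Fin.suc k))

conj : ∀ {n} → Vec ℕ n → ℕ → ℕ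
conj {n} la j = countF n (λ k → j ≤ᵇ lookup la k)

data Spin : Set where
  plus minus : Spin

_==ˢ_ : Spin → Spin → Bool
plus  ==ˢ plus  = true
minus ==ˢ minus = true
_     ==ˢ _     = false

spins : List Spin
spins = plus ∷ minus ∷ []

vecsOf : ∀ {a} {A : Set a} → List A → (k : ℕ) → List (Vec A k)
vecsOf xs zero    = [ [] ]
vecsOf xs (suc k) = concatMap (λ x → map (x ∷_) (vecsOf xs k)) xs

-- Grid with n rows (1..n top to bottom, Fin index i ↔ row toℕ i + 1) and
-- N columns.  Columns are stored left to right: position k : Fin N is the
-- column numbered j = N - toℕ k (columns are numbered right to left).
--   hor : row i, horizontal edges at positions 0..N from the left; the
--         vertex in position k has left edge k and right edge k+1;
--         position 0 is the left boundary edge, position N the right one.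
--   ver : levels 0..n from top to bottom; the vertex in row i has top edge
--         at level i (0-based) and bottom edge at level i+1; level 0 is the
--         top boundary, level n the bottom boundary.
record State (n N : ℕ) : Set where
  constructor state
  field
    hor : Vec (Vec Spin (suc N)) n
    ver : Vec (Vec Spin N) (suc n)
open State public

allStates : (n N : ℕ) → List (State n N)
allStates n N =
  map (λ p → state (proj₁ p) (proj₂ p))
      (cartesianProduct (vecsOf (vecsOf spins (suc N)) n)
                        (vecsOf (vecsOf spins N) (suc n)))

-- top boundary spin of column j: minus iff j = λ_k + n - k + 1 for some
-- k ∈ {1..n}  (with k = toℕ k' + 1 this is λ_k + n - toℕ k')
topSpin : ∀ {n} → Vec ℕ n → ℕ → Spin
topSpin {n} la j =
  if ⌊ any? (λ (k : Fin n) → j ≟ (lookup la k + n ∸ toℕ k)) ⌋ then minus else plus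

validB : ∀ {n N} → Vec ℕ n → State n N → Bool
validB {n} {N} la s =
  allF n (λ i → (lookup (lookup (hor s) i) Data.Fin.zero ==ˢ plus)
              ∧ (lookup (lookup (hor s) i) (fromℕ N) ==ˢ minus))
  ∧ allF N (λ k → (lookup (lookup (ver s) (fromℕ n)) k ==ˢ plus)
                ∧ (lookup (lookup (ver s) Data.Fin.zero) k ==ˢ topSpin la (N ∸ toℕ k)))

module _ {c ℓ} (F : Field c ℓ) where
  open Field F renaming (_+_ to _+F_; _*_ to _*F_)

  prodF : (n : ℕ) → (Fin n → Carrier) → Carrier
  prodF zero    f = 1#
  prodF (suc n) f = f Data.Fin.zero *F prodF n (λ k → f (Data.Fin.suc k))

  sumL : List Carrier → Carrier
  sumL = foldr _+F_ 0#

  -- vertex weight with spectral parameter z (= z_i) and a (= α_j);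
  -- spins in order (left, top, right, bottom)
  vweight : Carrier → Carrier → Spin → Spin → Spin → Spin → Carrier
  vweight z a plus  plus  plus  plus  = 1#
  vweight z a minus minus minus minus = 1#
  vweight z a plus  minus plus  minus = 1#
  vweight z a minus plus  minus plus  = (- (z *F (a ⁻¹))) +F (- 1#)
  vweight z a minus plus  plus  minus = - (z *F (a ⁻¹))
  vweight z a plus  minus minus plus  = 1#
  vweight z a _     _     _     _     = 0#

  stateWeight : ∀ {n N} → (Fin n → Carrier) → (ℕ → Carrier) → State n N → Carrier
  stateWeight {n} {N} z α s =
    prodF n (λ i → prodF N (λ k →
      vweight (z i) (α (N ∸ toℕ k))
        (lookup (lookup (hor s) i) (inject₁ k))
        (lookup (lookup (ver s) (inject₁ i)) k)
        (lookup (lookup (hor s) i) (Data.Fin.suc k))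
        (lookup (lookup (ver s) (Data.Fin.suc i)) k)))

  -- Z(𝔖^{Γ'}_{λ,∞}(z | α)), N = n + λ_1 columns; α is indexed from 1
  -- (α 0 is never used).
  Z : (n : ℕ) → Vec ℕ n → (Fin n → Carrier) → (ℕ → Carrier) → Carrier
  Z n la z α =
    sumL (map (stateWeight z α) (filter (λ s → validB la s ≟ᵇ true) (allStates n (n + first la))))

  -- the specialization z_i = - α_{μ_i + n + 1 - i}  (i = toℕ i' + 1)
  zAt : (α : ℕ → Carrier) → (n : ℕ) → Vec ℕ n → (Fin n → Carrier)
  zAt α n mu i = - α (lookup mu i + n ∸ toℕ i)

  -- ∏_{(i,j) ∈ λ} ( α_{n+1-i+λ_i} / α_{n-λ'_j+j} - 1 ),
  -- rows i = toℕ i' + 1, columns j = toℕ j' + 1 ∈ {1..λ_i}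
  boxProduct : (α : ℕ → Carrier) → (n : ℕ) → Vec ℕ n → Carrier
  boxProduct α n la =
    prodF n (λ i → prodF (lookup la i) (λ j' →
      let j = suc (toℕ j') in
      (α (n ∸ toℕ i + lookup la i) *F (α (n ∸ conj la j + j) ⁻¹)) +F (- 1#)))

module Submission where

-- A minus spin marks an edge carrying a path; at the six vertices of
-- nonzero weight paths are conserved (entering left/top, leaving
-- right/bottom).  At z_i = -α_{c i} the horizontal vertex of row i in
-- column c i has weight α_{c i}/α_{c i} - 1 = 0, so only "unblocked" states
-- survive, and in these at most m - i paths cross row i left of column
-- c m (PathBound).  Part 1: the top boundary of λ has paths at the columns
-- col m = λ_{m+1} + n - m; if λ_{m+1} > μ_{m+1}, the m + 1 paths left of
-- c m = μ_{m+1} + n - m violate the bound, so Z = 0 unless λ ⊆ μ.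
-- Part 2: for c = col the bound forces the unique "diagonal" state, whose
-- row i turns right at column col i and runs horizontally exactly through
-- the gap columns n - λ′_j + j (1 ≤ j ≤ λ_{i+1}), giving the box product.

open import Defs
open import Level using (_⊔_)
open import Data.Nat using (ℕ; zero; suc; _+_; _∸_; _≤_; _<_; z≤n; s≤s; s≤s⁻¹; _≤?_; _<?_; _≟_; _≤ᵇ_)
open import Data.Nat.Properties
  hiding (+-comm; +-assoc; +-identityˡ; +-identityʳ; *-comm; *-assoc; *-identityˡ; *-identityʳ)
import Data.Nat.Properties as ℕₚ
open import Data.Fin using (Fin; toℕ; fromℕ; fromℕ<; inject₁)
open import Data.Fin.Properties using (toℕ-fromℕ<; toℕ-fromℕ; toℕ-inject₁; toℕ<n; any?)
open import Data.Bool using (true; _∧_; if_then_else_)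
open import Data.Bool.Properties using () renaming (_≟_ to _≟ᵇ_)
open import Data.Vec using (Vec; []; _∷_; lookup; tabulate; replicate; head; tail)
open import Data.Vec.Properties using (lookup∘tabulate; tabulate∘lookup; tabulate-cong)
open import Data.List using (List; []; _∷_; map; filter; concatMap; cartesianProduct; _++_)
open import Data.Product using (_×_; _,_; proj₁; proj₂; ∃-syntax)
open import Data.Sum using (_⊎_; inj₁; inj₂)
open import Data.Empty using (⊥; ⊥-elim)
open import Relation.Nullary using (¬_; Dec; yes; no; does; contradiction)
open import Relation.Nullary.Decidable using (⌊_⌋; _×-dec_; dec-true; dec-false)
open import Relation.Unary using (Pred; Decidable)
open import Relation.Binary.Definitions using (tri<; tri≈; tri>)
open import Relation.Binary.PropositionalEquality
import Relation.Binary.Reasoning.Setoid as ≈-Reasoning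
import Algebra.Properties.Ring as RingProperties

least-index : ∀ {p} {P : Pred ℕ p} → Decidable P → ∀ k →
              ∃[ t ] (t ≤ k × (∀ m → m < t → ¬ P m) × (t < k → P t))
least-index P? zero = 0 , z≤n , (λ _ ()) , (λ ())
least-index {P = P} P? (suc k) with least-index P? k
... | t , t≤k , before , at with m≤n⇒m<n∨m≡n t≤k
...   | inj₁ t<k = t , m≤n⇒m≤1+n t≤k , before , (λ _ → at t<k)
...   | inj₂ refl with P? t
...     | yes Pt = t , n≤1+n t , before , (λ _ → Pt)
...     | no ¬Pt = suc t , ≤-refl , before′ , (λ t<t → contradiction t<t (<-irrefl refl))
  where
  before′ : ∀ m → m < suc t → ¬ P m
  before′ m m<1+t with m≤n⇒m<n∨m≡n (s≤s⁻¹ m<1+t)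
  ... | inj₁ m<t  = before m m<t
  ... | inj₂ refl = ¬Pt

bracket : ∀ (q : ℕ → ℕ) {i k} n → i ≤ n → q i < k → k ≤ q n →
          ∃[ m ] (i ≤ m × m < n × q m < k × k ≤ q (suc m))
bracket q {i} {k} zero    z≤n qi<k k≤q0 = ⊥-elim (<-irrefl refl (<-≤-trans qi<k k≤q0))
bracket q {i} {k} (suc n) i≤1+n qi<k k≤q1+n with m≤n⇒m<n∨m≡n i≤1+n
... | inj₂ refl = ⊥-elim (<-irrefl refl (<-≤-trans qi<k k≤q1+n))
... | inj₁ i<1+n with q n <? k
...   | yes qn<k = n , s≤s⁻¹ i<1+n , ≤-refl , qn<k , k≤q1+n
...   | no  qn≮k with bracket q n (s≤s⁻¹ i<1+n) qi<k (≮⇒≥ qn≮k)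
...     | m , i≤m , m<n , qm<k , k≤q1+m = m , i≤m , m<n⇒m<1+n m<n , qm<k , k≤q1+m

increasing-strict : ∀ (b : ℕ → ℕ) → (∀ j → b j < b (suc j)) → ∀ {j j′} → j < j′ → b j < b j′
increasing-strict b inc {j} {suc j′} (s≤s j≤j′) with m≤n⇒m<n∨m≡n j≤j′
... | inj₁ j<j′  = <-trans (increasing-strict b inc j<j′) (inc j′)
... | inj₂ refl = inc j

increasing-≥ : ∀ (b : ℕ → ℕ) → (∀ j → b j < b (suc j)) → ∀ j → j ≤ b j
increasing-≥ b inc zero    = z≤n
increasing-≥ b inc (suc j) = <-≤-trans (s≤s (increasing-≥ b inc j)) (inc j)

occupancy : Spin → ℕ
occupancy plus  = 0
occupancy minus = 1

-- The six spin configurations (left, top, right, bottom) of nonzero weight.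
data Admissible : Spin → Spin → Spin → Spin → Set where
  empty      : Admissible plus  plus  plus  plus
  crossing   : Admissible minus minus minus minus
  vertical   : Admissible plus  minus plus  minus
  horizontal : Admissible minus plus  minus plus
  turnDown   : Admissible minus plus  plus  minus
  turnRight  : Admissible plus  minus minus plus

conservation : ∀ {l t r b} → Admissible l t r b →
               occupancy l + occupancy t ≡ occupancy r + occupancy b
conservation empty      = refl
conservation crossing   = refl
conservation vertical   = refl
conservation horizontal = refl
conservation turnDown   = refl
conservation turnRight  = refl

bottom-unique : ∀ {l t r b b′} → Admissible l t r b → Admissible l t r b′ → b ≡ b′
bottom-unique empty      empty      = refl
bottom-unique crossing   crossing   = refl
bottom-unique vertical   vertical   = refl
bottom-unique horizontal horizontal = refl
bottom-unique turnDown   turnDown   = refl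
bottom-unique turnRight  turnRight  = refl

spin-cases : ∀ (s : Spin) → s ≡ plus ⊎ s ≡ minus
spin-cases plus  = inj₁ refl
spin-cases minus = inj₂ refl

unoccupied : ∀ {s} → occupancy s ≡ 0 → s ≡ plus
unoccupied {plus}  _  = refl
unoccupied {minus} ()

occupied : ∀ {s} → 1 ≤ occupancy s → s ≡ minus
occupied {plus}  ()
occupied {minus} _ = refl

occupancy≤1 : ∀ s → occupancy s ≤ 1
occupancy≤1 plus  = z≤n
occupancy≤1 minus = ≤-refl

paths : (ℕ → Spin) → ℕ → ℕ
paths f zero    = 0
paths f (suc k) = paths f k + occupancy (f k)

paths-mono : ∀ f {k K} → k ≤ K → paths f k ≤ paths f K
paths-mono f {k} {zero}  z≤n = ≤-refl
paths-mono f {k} {suc K} k≤1+K with m≤n⇒m<n∨m≡n k≤1+K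
... | inj₁ k<1+K = ≤-trans (paths-mono f (s≤s⁻¹ k<1+K)) (m≤m+n (paths f K) _)
... | inj₂ refl  = ≤-refl

paths-none : ∀ f K → (∀ k → k < K → f k ≡ plus) → paths f K ≡ 0
paths-none f zero    _    = refl
paths-none f (suc K) none
  rewrite paths-none f K (λ k k<K → none k (m<n⇒m<1+n k<K)) | none K ≤-refl = refl

paths-occupied : ∀ f k → f k ≡ minus → paths f (suc k) ≡ suc (paths f k)
paths-occupied f k fk rewrite fk = ℕₚ.+-comm (paths f k) 1

paths-lower : ∀ f (q : ℕ → ℕ) i m k → i ≤ m →
              (∀ j → i ≤ j → j ≤ m → f (q j) ≡ minus) →
              (∀ j → i ≤ j → j < m → q j < q (suc j)) →
              q m < k → suc (m ∸ i) ≤ paths f k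
paths-lower f q i m k i≤m occ inc qm<k with m≤n⇒m<n∨m≡n i≤m
... | inj₂ refl rewrite n∸n≡0 i =
  ≤-trans (subst (1 ≤_) (sym (paths-occupied f (q i) (occ i ≤-refl ≤-refl))) (s≤s z≤n))
          (paths-mono f qm<k)
paths-lower f q i (suc m) k i≤1+m occ inc qm<k | inj₁ i<1+m =
  begin
    suc (suc m ∸ i)          ≡⟨ cong suc (+-∸-assoc 1 i≤m) ⟩
    suc (suc (m ∸ i))        ≤⟨ s≤s earlier ⟩
    suc (paths f (q (suc m))) ≡⟨ sym (paths-occupied f (q (suc m)) (occ (suc m) (<⇒≤ i<1+m) ≤-refl)) ⟩
    paths f (suc (q (suc m))) ≤⟨ paths-mono f qm<k ⟩
    paths f k                ∎
  where
  open ≤-Reasoning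
  i≤m : i ≤ m
  i≤m = s≤s⁻¹ i<1+m
  earlier : suc (m ∸ i) ≤ paths f (q (suc m))
  earlier = paths-lower f q i m (q (suc m)) i≤m
              (λ j i≤j j≤m → occ j i≤j (m≤n⇒m≤1+n j≤m))
              (λ j i≤j j<m → inc j i≤j (m<n⇒m<1+n j<m))
              (inc m i≤m ≤-refl)

row-conservation : ∀ (H T B : ℕ → Spin) K →
  (∀ k → k < K → Admissible (H k) (T k) (H (suc k)) (B k)) →
  ∀ k → k ≤ K → paths T k + occupancy (H 0) ≡ paths B k + occupancy (H k)
row-conservation H T B K adm zero    _     = refl
row-conservation H T B K adm (suc k) 1+k≤K =
  begin
    paths T k + occupancy (T k) + occupancy (H 0)   ≡⟨ ℕₚ.+-assoc (paths T k) _ _ ⟩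
    paths T k + (occupancy (T k) + occupancy (H 0)) ≡⟨ cong (paths T k +_) (ℕₚ.+-comm (occupancy (T k)) _) ⟩
    paths T k + (occupancy (H 0) + occupancy (T k)) ≡⟨ ℕₚ.+-assoc (paths T k) _ _ ⟨
    paths T k + occupancy (H 0) + occupancy (T k)   ≡⟨ cong (_+ occupancy (T k))
                                                           (row-conservation H T B K adm k (<⇒≤ 1+k≤K)) ⟩
    paths B k + occupancy (H k) + occupancy (T k)   ≡⟨ ℕₚ.+-assoc (paths B k) _ _ ⟩
    paths B k + (occupancy (H k) + occupancy (T k)) ≡⟨ cong (paths B k +_) (conservation (adm k 1+k≤K)) ⟩
    paths B k + (occupancy (H (suc k)) + occupancy (B k)) ≡⟨ cong (paths B k +_) (ℕₚ.+-comm (occupancy (H (suc k))) _) ⟩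
    paths B k + (occupancy (B k) + occupancy (H (suc k))) ≡⟨ ℕₚ.+-assoc (paths B k) _ _ ⟨
    paths B k + occupancy (B k) + occupancy (H (suc k)) ∎
  where open ≡-Reasoning

-- Row i is "blocked"
-- at column c i (position N - c i): no path runs horizontally through that
-- vertex.  Then at most m - i paths cross row i to the left of column c m:
-- each row can lose at most one path to the right, and row i loses
-- everything to the left of column c i.
module PathBound (n N : ℕ) (H V : ℕ → ℕ → Spin) (c : ℕ → ℕ)
  (admissible  : ∀ i k → i < n → k < N →
                 Admissible (H i k) (V i k) (H i (suc k)) (V (suc i) k))
  (left-boundary   : ∀ i → i < n → H i 0 ≡ plus)
  (bottom-boundary : ∀ k → k < N → V n k ≡ plus)
  (c-decreasing : ∀ m → m < n → c (suc m) < c m)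
  (blocked     : ∀ i k → i < n → k < N → N ∸ k ≡ c i →
                 H i k ≡ minus → V (suc i) k ≡ plus → ⊥)
  where

  row-paths : ∀ i → i < n → ∀ k → k ≤ N →
              paths (V i) k ≡ paths (V (suc i)) k + occupancy (H i k)
  row-paths i i<n k k≤N =
    begin
      paths (V i) k                           ≡⟨ ℕₚ.+-identityʳ _ ⟨
      paths (V i) k + 0                       ≡⟨ cong (λ s → paths (V i) k + occupancy s) (left-boundary i i<n) ⟨
      paths (V i) k + occupancy (H i 0)       ≡⟨ row-conservation (H i) (V i) (V (suc i)) N
                                                   (λ k′ k′<N → admissible i k′ i<n k′<N) k k≤N ⟩
      paths (V (suc i)) k + occupancy (H i k) ∎
    where open ≡-Reasoning

  PathsBelow : ℕ → Set
  PathsBelow i = ∀ m → i ≤ m → paths (V i) (N ∸ c m) ≤ m ∸ i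

  blocked-row-empty : ∀ i → i < n → PathsBelow (suc i) → paths (V i) (N ∸ c i) ≡ 0
  blocked-row-empty i i<n below with N ≤? c i
  ... | yes N≤ci rewrite m≤n⇒m∸n≡0 N≤ci = refl
  ... | no  N≰ci = begin
      paths (V i) k                           ≡⟨ row-paths i i<n k (m∸n≤m N (c i)) ⟩
      paths (V (suc i)) k + occupancy (H i k) ≡⟨ cong₂ _+_ bottom-none (cong occupancy left-empty) ⟩
      0                                       ∎
    where
    open ≡-Reasoning
    k : ℕ
    k = N ∸ c i
    ci<N : c i < N
    ci<N = ≰⇒> N≰ci
    k<N : k < N
    k<N = ∸-monoʳ-< (≤-<-trans z≤n (c-decreasing i i<n)) (<⇒≤ ci<N)
    next-empty : paths (V (suc i)) (suc k) ≡ 0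
    next-empty = n≤0⇒n≡0 (≤-trans (paths-mono (V (suc i)) (∸-monoʳ-< (c-decreasing i i<n) (<⇒≤ ci<N)))
                                  (subst (paths (V (suc i)) (N ∸ c (suc i)) ≤_) (n∸n≡0 i) (below (suc i) ≤-refl)))
    bottom-none : paths (V (suc i)) k ≡ 0
    bottom-none = m+n≡0⇒m≡0 _ next-empty
    bottom-empty : V (suc i) k ≡ plus
    bottom-empty = unoccupied (m+n≡0⇒n≡0 (paths (V (suc i)) k) next-empty)
    left-empty : H i k ≡ plus
    left-empty with spin-cases (H i k)
    ... | inj₁ e = e
    ... | inj₂ e = ⊥-elim (blocked i k i<n k<N (m∸[m∸n]≡n (<⇒≤ ci<N)) e bottom-empty)

  paths-below-step : ∀ i → i < n → PathsBelow (suc i) → PathsBelow i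
  paths-below-step i i<n below m i≤m with m≤n⇒m<n∨m≡n i≤m
  ... | inj₂ refl rewrite blocked-row-empty i i<n below = z≤n
  ... | inj₁ i<m = begin
      paths (V i) K                           ≡⟨ row-paths i i<n K (m∸n≤m N (c m)) ⟩
      paths (V (suc i)) K + occupancy (H i K) ≤⟨ +-mono-≤ (below m i<m) (occupancy≤1 (H i K)) ⟩
      m ∸ suc i + 1                           ≡⟨ ℕₚ.+-comm (m ∸ suc i) 1 ⟩
      suc (m ∸ suc i)                         ≡⟨ +-∸-assoc 1 i<m ⟨
      m ∸ i                                   ∎
    where
    open ≤-Reasoning
    K : ℕ
    K = N ∸ c m

  paths-below : ∀ i → i ≤ n → PathsBelow i
  paths-below i i≤n = from-bottom (n ∸ i) i (m∸n+n≡m i≤n)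
    where
    from-bottom : ∀ d i → d + i ≡ n → PathsBelow i
    from-bottom zero    i refl m i≤m = subst (_≤ m ∸ i) (sym (paths-none (V i) (N ∸ c m)
                                         (λ k k< → bottom-boundary k (<-≤-trans k< (m∸n≤m N (c m)))))) z≤n
    from-bottom (suc d) i d+i≡n =
      paths-below-step i (subst (i <_) d+i≡n (s≤s (m≤n+m i d)))
        (from-bottom d (suc i) (trans (+-suc d i) d+i≡n))

-- Entry m of a vector, or the default d beyond its length: the
-- combinatorics below is phrased with ℕ-indexed sequences.
entry : ∀ {A : Set} {n} → Vec A n → ℕ → A → A
entry []       m       d = d
entry (x ∷ xs) zero    d = x
entry (x ∷ xs) (suc m) d = entry xs m d

entry-lookup : ∀ {A : Set} {n} (xs : Vec A n) (i : Fin n) d → entry xs (toℕ i) d ≡ lookup xs i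
entry-lookup (x ∷ xs) Fin.zero    d = refl
entry-lookup (x ∷ xs) (Fin.suc i) d = entry-lookup xs i d

entry-beyond : ∀ {A : Set} {n} (xs : Vec A n) m d → n ≤ m → entry xs m d ≡ d
entry-beyond []       m       d _         = refl
entry-beyond (x ∷ xs) (suc m) d (s≤s n≤m) = entry-beyond xs m d n≤m

countF-cong : ∀ k (f g : Fin k → _) → (∀ K → f K ≡ g K) → countF k f ≡ countF k g
countF-cong zero    f g f≗g = refl
countF-cong (suc k) f g f≗g rewrite f≗g Fin.zero =
  cong (_ +_) (countF-cong k _ _ (λ K → f≗g (Fin.suc K)))

countF-prefix : ∀ {p} {P : Pred ℕ p} (P? : Decidable P) k t → t ≤ k →
                (∀ m → m < t → P m) → (∀ m → t ≤ m → m < k → ¬ P m) →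
                countF k (λ K → does (P? (toℕ K))) ≡ t
countF-prefix P? zero    zero    _         _    _    = refl
countF-prefix P? (suc k) zero    _         _    none rewrite dec-false (P? 0) (none 0 z≤n (s≤s z≤n)) =
  countF-prefix (λ m → P? (suc m)) k 0 z≤n (λ _ ()) (λ m _ m<k → none (suc m) z≤n (s≤s m<k))
countF-prefix P? (suc k) (suc t) (s≤s t≤k) all  none rewrite dec-true (P? 0) (all 0 (s≤s z≤n)) =
  cong suc (countF-prefix (λ m → P? (suc m)) k t t≤k (λ m m<t → all (suc m) (s≤s m<t))
                          (λ m t≤m m<k → none (suc m) (s≤s t≤m) (s≤s m<k)))

-- A partition with at most n parts, viewed as an ℕ-indexed sequence
-- (row m is λ_{m+1}, zero for m ≥ n), together with the columns
-- col m = λ_{m+1} + n - m at which the top boundary carries a path.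
module Partition {n} (ν : Vec ℕ n) (isPartition : IsPartition ν) where

  row : ℕ → ℕ
  row m = entry ν m 0

  row-antitone : ∀ {m m′} → m ≤ m′ → row m′ ≤ row m
  row-antitone {m} {m′} m≤m′ with m′ <? n
  ... | no  m′≮n rewrite entry-beyond ν m′ 0 (≮⇒≥ m′≮n) = z≤n
  ... | yes m′<n =
    subst₂ _≤_ (trans (sym (entry-lookup ν I′ 0)) (cong (λ x → row x) (toℕ-fromℕ< m′<n)))
               (trans (sym (entry-lookup ν I 0)) (cong (λ x → row x) (toℕ-fromℕ< m<n)))
               (isPartition I I′ (subst₂ _≤_ (sym (toℕ-fromℕ< m<n)) (sym (toℕ-fromℕ< m′<n)) m≤m′))
    where
    m<n : m < n
    m<n = ≤-<-trans m≤m′ m′<n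
    I I′ : Fin n
    I  = fromℕ< m<n
    I′ = fromℕ< m′<n

  row≤first : ∀ m → row m ≤ first ν
  row≤first m = subst (row m ≤_) (first-row ν) (row-antitone z≤n)
    where
    first-row : ∀ {k} (xs : Vec ℕ k) → entry xs 0 0 ≡ first xs
    first-row []      = refl
    first-row (x ∷ _) = refl

  col : ℕ → ℕ
  col m = row m + n ∸ m

  col+index : ∀ {m} → m ≤ n → col m + m ≡ row m + n
  col+index {m} m≤n = m∸n+n≡m (≤-trans m≤n (m≤n+m n (row m)))

  col-lookup : ∀ (I : Fin n) → col (toℕ I) ≡ lookup ν I + n ∸ toℕ I
  col-lookup I = cong (λ x → x + n ∸ toℕ I) (entry-lookup ν I 0)

  col≤ : ∀ m → col m ≤ n + first ν
  col≤ m = ≤-trans (m∸n≤m _ m) (subst (row m + n ≤_) (ℕₚ.+-comm (first ν) n) (+-monoˡ-≤ n (row≤first m)))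

  col-antitone : ∀ {m m′} → m ≤ m′ → col m′ ≤ col m
  col-antitone {m} {m′} m≤m′ =
    ≤-trans (∸-monoˡ-≤ m′ (+-monoˡ-≤ n (row-antitone m≤m′))) (∸-monoʳ-≤ (row m + n) m≤m′)

  col-strict : ∀ {m m′} → m < m′ → m′ ≤ n → col m′ < col m
  col-strict {m} {m′} m<m′ m′≤n =
    ≤-<-trans (∸-monoˡ-≤ m′ (+-monoˡ-≤ n (row-antitone (<⇒≤ m<m′))))
              (∸-monoʳ-< m<m′ (≤-trans m′≤n (m≤n+m n (row m))))

  col-beyond : ∀ {m} → n ≤ m → col m ≡ 0
  col-beyond {m} n≤m rewrite entry-beyond ν m 0 n≤m = m≤n⇒m∸n≡0 n≤m

  col-positive : ∀ {m} → m < n → 0 < col m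
  col-positive {m} m<n = ≤-trans (m<n⇒0<n∸m m<n) (∸-monoˡ-≤ m (m≤n+m n (row m)))

  ColumnLength : ℕ → ℕ → Set
  ColumnLength j t = t ≤ n × (∀ m → m < t → j ≤ row m) × (∀ m → t ≤ m → m < n → row m < j)

  conj-length : ∀ {j t} → ColumnLength j t → conj ν j ≡ t
  conj-length {j} {t} (t≤n , long , short) =
    trans (countF-cong n _ (λ K → does (j ≤? row (toℕ K))) (λ K → cong (j ≤ᵇ_) (sym (entry-lookup ν K 0))))
          (countF-prefix (λ m → j ≤? row m) n t t≤n long (λ m t≤m m<n → <⇒≱ (short m t≤m m<n)))

  conj-spec : ∀ j → ColumnLength j (conj ν j)
  conj-spec j with least-index (λ m → row m <? j) n
  ... | t , t≤n , before , at = subst (ColumnLength j) (sym (conj-length len)) len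
    where
    len : ColumnLength j t
    len = t≤n , (λ m m<t → ≮⇒≥ (before m m<t))
        , (λ m t≤m m<n → ≤-<-trans (row-antitone t≤m) (at (≤-<-trans t≤m m<n)))

  conj-antitone : ∀ j → conj ν (suc j) ≤ conj ν j
  conj-antitone j with conj-spec j | conj-spec (suc j)
  ... | t≤n , _ , short | _ , long′ , _ with conj ν (suc j) ≤? conj ν j
  ...   | yes ≤t = ≤t
  ...   | no  ≰t = contradiction (short (conj ν j) ≤-refl (<-≤-trans t<t′ (proj₁ (conj-spec (suc j)))))
                                 (≤⇒≯ (<⇒≤ (long′ (conj ν j) t<t′)))
    where
    t<t′ : conj ν j < conj ν (suc j)
    t<t′ = ≰⇒> ≰t

  gap : ℕ → ℕ
  gap j = n ∸ conj ν j + j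

  gap+conj : ∀ j → gap j + conj ν j ≡ n + j
  gap+conj j = begin
      n ∸ t + j + t   ≡⟨ ℕₚ.+-assoc (n ∸ t) j t ⟩
      n ∸ t + (j + t) ≡⟨ cong (n ∸ t +_) (ℕₚ.+-comm j t) ⟩
      n ∸ t + (t + j) ≡⟨ ℕₚ.+-assoc (n ∸ t) t j ⟨
      n ∸ t + t + j   ≡⟨ cong (_+ j) (m∸n+n≡m (proj₁ (conj-spec j))) ⟩
      n + j           ∎
    where
    open ≡-Reasoning
    t : ℕ
    t = conj ν j

  gap<col : ∀ j m → m < conj ν j → gap j < col m
  gap<col j m m<t = +-cancelʳ-< (conj ν j) (gap j) (col m) (begin-strict
      gap j + conj ν j ≡⟨ gap+conj j ⟩
      n + j            ≤⟨ +-monoʳ-≤ n (proj₁ (proj₂ (conj-spec j)) m m<t) ⟩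
      n + row m        ≡⟨ ℕₚ.+-comm n (row m) ⟩
      row m + n        ≡⟨ col+index (<⇒≤ (<-≤-trans m<t (proj₁ (conj-spec j)))) ⟨
      col m + m        <⟨ +-monoʳ-< (col m) m<t ⟩
      col m + conj ν j ∎)
    where open ≤-Reasoning

  col<gap : ∀ j m → conj ν j ≤ m → m < n → col m < gap j
  col<gap j m t≤m m<n = +-cancelʳ-< m (col m) (gap j) (begin-strict
      col m + m        ≡⟨ col+index (<⇒≤ m<n) ⟩
      row m + n        <⟨ +-monoˡ-< n (proj₂ (proj₂ (conj-spec j)) m t≤m m<n) ⟩
      j + n            ≡⟨ ℕₚ.+-comm j n ⟩
      n + j            ≡⟨ gap+conj j ⟨
      gap j + conj ν j ≤⟨ +-monoʳ-≤ (gap j) t≤m ⟩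
      gap j + m        ∎)
    where open ≤-Reasoning

  gap-increasing : ∀ j → gap j < gap (suc j)
  gap-increasing j = +-cancelʳ-< (conj ν j) (gap j) (gap (suc j)) (begin-strict
      gap j + conj ν j               ≡⟨ gap+conj j ⟩
      n + j                          <⟨ +-monoʳ-< n (n<1+n j) ⟩
      n + suc j                      ≡⟨ gap+conj (suc j) ⟨
      gap (suc j) + conj ν (suc j)   ≤⟨ +-monoʳ-≤ (gap (suc j)) (conj-antitone j) ⟩
      gap (suc j) + conj ν j         ∎)
    where open ≤-Reasoning

  -- The columns of row i that carry no path of the rows i, i + 1, … in the
  -- diagonal configuration: left of col i and different from every col m.
  Gap : ℕ → ℕ → Set
  Gap i c = c < col i × (∀ m → i ≤ m → m < n → c ≢ col m)

  nonempty-row : ∀ {i} → 1 ≤ row i → i < n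
  nonempty-row {i} 1≤row with i <? n
  ... | yes i<n = i<n
  ... | no  i≮n = contradiction (subst (1 ≤_) (entry-beyond ν i 0 (≮⇒≥ i≮n)) 1≤row) λ ()

  gap-Gap : ∀ {i j} → 1 ≤ j → j ≤ row i → Gap i (gap j)
  gap-Gap {i} {j} 1≤j j≤row = gap<col j i i<t , distinct
    where
    i<t : i < conj ν j
    i<t with conj ν j ≤? i
    ... | no  t≰i = ≰⇒> t≰i
    ... | yes t≤i = contradiction j≤row
                      (<⇒≱ (proj₂ (proj₂ (conj-spec j)) i t≤i (nonempty-row (≤-trans 1≤j j≤row))))
    distinct : ∀ m → i ≤ m → m < n → gap j ≢ col m
    distinct m _ m<n e with m <? conj ν j
    ... | yes m<t = <-irrefl e (gap<col j m m<t)
    ... | no  m≮t = <-irrefl (sym e) (col<gap j m (≮⇒≥ m≮t) m<n)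

  SplitAt : ℕ → ℕ → Set
  SplitAt c t′ = suc t′ ≤ n × (∀ m → m ≤ t′ → c < col m) × (suc t′ < n → col (suc t′) < c)

  -- a gap of row i forces i < n, since col i = 0 beyond the last row
  Gap-row : ∀ {i c} → Gap i c → i < n
  Gap-row {i} {c} (c<col-i , _) with i <? n
  ... | yes i<n = i<n
  ... | no  i≮n = contradiction (subst (c <_) (col-beyond (≮⇒≥ i≮n)) c<col-i) λ ()

  -- t = t′ + 1 is the first row whose column lies left of the gap c
  Gap-split : ∀ {i c} → Gap i c → ∃[ t′ ] (i ≤ t′ × SplitAt c t′)
  Gap-split {i} {c} g@(c<col-i , distinct) with least-index (λ m → col m <? c) n
  ... | t , t≤n , before , at with i <? t
  ...   | no  i≮t = contradiction (at (≤-<-trans (≮⇒≥ i≮t) (Gap-row g)))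
                                  (≤⇒≯ (≤-trans (<⇒≤ c<col-i) (col-antitone (≮⇒≥ i≮t))))
  ...   | yes (s≤s i≤t′) = _ , i≤t′ , t≤n , (λ m m≤t′ → right-of-c m (s≤s m≤t′)) , at
    where
    right-of-c : ∀ m → m < t → c < col m
    right-of-c m m<t with m <? i
    ... | yes m<i = <-≤-trans c<col-i (col-antitone (<⇒≤ m<i))
    ... | no  m≮i = ≤∧≢⇒< (≮⇒≥ (before m m<t)) (distinct m (≮⇒≥ m≮i) (<-≤-trans m<t t≤n))

  split-length : ∀ {c t′} → SplitAt c t′ →
                    n ≤ c + suc t′ × ColumnLength (c + suc t′ ∸ n) (suc t′)
  split-length {c} {t′} (t≤n , right , left) = n≤c+t , t≤n , long , short
    where
    t : ℕ
    t = suc t′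
    n≤c+t : n ≤ c + t
    n≤c+t with m≤n⇒m<n∨m≡n t≤n
    ... | inj₂ refl = m≤n+m n c
    ... | inj₁ t<n  = begin
        n         ≤⟨ m≤n+m n (row t) ⟩
        row t + n ≡⟨ col+index t≤n ⟨
        col t + t ≤⟨ +-monoˡ-≤ t (<⇒≤ (left t<n)) ⟩
        c + t     ∎
      where open ≤-Reasoning
    j : ℕ
    j = c + t ∸ n
    j+n : j + n ≡ c + t
    j+n = m∸n+n≡m n≤c+t
    long : ∀ m → m < t → j ≤ row m
    long m (s≤s m≤t′) = ≤-trans (+-cancelʳ-≤ n j (row t′) (begin
        j + n          ≡⟨ j+n ⟩
        c + suc t′     ≡⟨ +-suc c t′ ⟩
        suc c + t′     ≤⟨ +-monoˡ-≤ t′ (right t′ ≤-refl) ⟩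
        col t′ + t′    ≡⟨ col+index (<⇒≤ t≤n) ⟩
        row t′ + n     ∎)) (row-antitone m≤t′)
      where open ≤-Reasoning
    short : ∀ m → t ≤ m → m < n → row m < j
    short m t≤m m<n = ≤-<-trans (row-antitone t≤m) (+-cancelʳ-< n (row t) j (begin-strict
        row t + n ≡⟨ col+index t≤n ⟨
        col t + t <⟨ +-monoˡ-< t (left (≤-<-trans t≤m m<n)) ⟩
        c + t     ≡⟨ j+n ⟨
        j + n     ∎))
      where open ≤-Reasoning

  Gap-gap : ∀ {i c} → 1 ≤ c → Gap i c → ∃[ j ] (1 ≤ j × j ≤ row i × gap j ≡ c)
  Gap-gap {i} {c} 1≤c g with Gap-split g
  ... | t′ , i≤t′ , bd@(t≤n , _ , _) with split-length bd
  ...   | n≤c+t , length@(_ , long , short) = j , 1≤j , j≤row-i , gap≡c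
    where
    t j : ℕ
    t = suc t′
    j = c + t ∸ n
    j+n : j + n ≡ c + t
    j+n = m∸n+n≡m n≤c+t
    1≤j : 1 ≤ j
    1≤j with m≤n⇒m<n∨m≡n t≤n
    ... | inj₁ t<n  = ≤-<-trans z≤n (short t ≤-refl t<n)
    ... | inj₂ refl = subst (1 ≤_) (sym (+-cancelʳ-≡ n j c j+n)) 1≤c
    j≤row-i : j ≤ row i
    j≤row-i = long i (s≤s i≤t′)
    gap≡c : gap j ≡ c
    gap≡c = +-cancelʳ-≡ t (gap j) c (begin
        gap j + t        ≡⟨ cong (gap j +_) (conj-length length) ⟨
        gap j + conj ν j ≡⟨ gap+conj j ⟩
        n + j            ≡⟨ ℕₚ.+-comm n j ⟩
        j + n            ≡⟨ j+n ⟩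
        c + t            ∎)
      where open ≡-Reasoning

module FieldFacts {c ℓ} (F : Field c ℓ) where
  open Field F renaming (_+_ to _+F_; _*_ to _*F_; refl to ≈-refl; sym to ≈-sym; trans to ≈-trans; reflexive to ≈-reflexive)
  open RingProperties ring using (-‿distribˡ-*; -‿involutive)

  sumOver : ∀ {a} {A : Set a} → (A → Carrier) → List A → Carrier
  sumOver f L = sumL F (map f L)

  sum-cong : ∀ {a} {A : Set a} {f g : A → Carrier} xs → (∀ x → f x ≈ g x) → sumOver f xs ≈ sumOver g xs
  sum-cong []       f≈g = ≈-refl
  sum-cong (x ∷ xs) f≈g = +-cong (f≈g x) (sum-cong xs f≈g)

  sum-zero : ∀ {a} {A : Set a} (f : A → Carrier) xs → (∀ x → f x ≈ 0#) → sumOver f xs ≈ 0#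
  sum-zero f []       f≈0 = ≈-refl
  sum-zero f (x ∷ xs) f≈0 = ≈-trans (+-cong (f≈0 x) (sum-zero f xs f≈0)) (+-identityˡ 0#)

  sum-map : ∀ {a b} {A : Set a} {B : Set b} (f : B → Carrier) (g : A → B) xs →
            sumOver f (map g xs) ≈ sumOver (λ x → f (g x)) xs
  sum-map f g []       = ≈-refl
  sum-map f g (x ∷ xs) = +-congˡ (sum-map f g xs)

  sum-++ : ∀ {a} {A : Set a} (f : A → Carrier) xs ys →
           sumOver f (xs ++ ys) ≈ sumOver f xs +F sumOver f ys
  sum-++ f []       ys = ≈-sym (+-identityˡ _)
  sum-++ f (x ∷ xs) ys = ≈-trans (+-congˡ (sum-++ f xs ys)) (≈-sym (+-assoc _ _ _))

  sum-concatMap : ∀ {a b} {A : Set a} {B : Set b} (f : B → Carrier) (g : A → List B) xs →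
                  sumOver f (concatMap g xs) ≈ sumOver (λ x → sumOver f (g x)) xs
  sum-concatMap f g []       = ≈-refl
  sum-concatMap f g (x ∷ xs) = ≈-trans (sum-++ f (g x) (concatMap g xs)) (+-congˡ (sum-concatMap f g xs))

  sum-cartesian : ∀ {a b} {A : Set a} {B : Set b} (f : A × B → Carrier) xs ys →
                  sumOver f (cartesianProduct xs ys) ≈ sumOver (λ x → sumOver (λ y → f (x , y)) ys) xs
  sum-cartesian f []       ys = ≈-refl
  sum-cartesian f (x ∷ xs) ys =
    ≈-trans (sum-++ f (map (x ,_) ys) _) (+-cong (sum-map f (x ,_) ys) (sum-cartesian f xs ys))

  restrict : ∀ {a p} {A : Set a} {P : Pred A p} → Decidable P → (A → Carrier) → A → Carrier
  restrict P? w x = if does (P? x) then w x else 0#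

  sum-filter : ∀ {a p} {A : Set a} {P : Pred A p} (P? : Decidable P) (w : A → Carrier) xs →
               sumOver w (filter P? xs) ≈ sumOver (restrict P? w) xs
  sum-filter P? w []       = ≈-refl
  sum-filter P? w (x ∷ xs) with P? x
  ... | yes _ = +-congˡ (sum-filter P? w xs)
  ... | no  _ = ≈-trans (sum-filter P? w xs) (≈-sym (+-identityˡ _))

  -- L lists every element of A exactly once, expressed through sums: a
  -- function supported at a single point x₀ sums to its value at x₀.
  Enumerates : ∀ {a} {A : Set a} → List A → Set (a ⊔ c ⊔ ℓ)
  Enumerates {A = A} L = ∀ x₀ (f : A → Carrier) → (∀ y → y ≢ x₀ → f y ≈ 0#) → sumOver f L ≈ f x₀

  enumerates-spins : Enumerates spins
  enumerates-spins plus  f off = ≈-trans (+-congˡ (≈-trans (+-congʳ (off minus λ ())) (+-identityˡ 0#))) (+-identityʳ _)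
  enumerates-spins minus f off = ≈-trans (+-congʳ (off plus λ ())) (≈-trans (+-identityˡ _) (+-identityʳ _))

  enumerates-cartesian : ∀ {a b} {A : Set a} {B : Set b} (xs : List A) (ys : List B) →
    Enumerates xs → Enumerates ys → Enumerates (cartesianProduct xs ys)
  enumerates-cartesian xs ys enum-xs enum-ys (x₀ , y₀) f off =
    ≈-trans (sum-cartesian f xs ys)
      (≈-trans (enum-xs x₀ (λ x → sumOver (λ y → f (x , y)) ys)
                 (λ x x≢x₀ → sum-zero (λ y → f (x , y)) ys (λ y → off (x , y) (λ e → x≢x₀ (cong proj₁ e)))))
               (enum-ys y₀ (λ y → f (x₀ , y)) (λ y y≢y₀ → off (x₀ , y) (λ e → y≢y₀ (cong proj₂ e)))))

  enumerates-map : ∀ {a b} {A : Set a} {B : Set b} (g : A → B) (g⁻ : B → A) →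
    (∀ x → g⁻ (g x) ≡ x) → (∀ y → g (g⁻ y) ≡ y) →
    ∀ xs → Enumerates xs → Enumerates (map g xs)
  enumerates-map g g⁻ left right xs enum y₀ f off =
    ≈-trans (sum-map f g xs)
      (≈-trans (enum (g⁻ y₀) (λ x → f (g x))
                 (λ x x≢ → off (g x) (λ e → x≢ (trans (sym (left x)) (cong g⁻ e)))))
               (≈-reflexive (cong f (right y₀))))

  enumerates-vecs : ∀ {a} {A : Set a} (xs : List A) → Enumerates xs → ∀ k → Enumerates (vecsOf xs k)
  enumerates-vecs xs enum zero    []        f off = +-identityʳ _
  enumerates-vecs xs enum (suc k) (x₀ ∷ v₀) f off =
    ≈-trans (sum-concatMap f (λ x → map (x ∷_) (vecsOf xs k)) xs)
      (≈-trans (sum-cong xs (λ x → sum-map f (x ∷_) (vecsOf xs k)))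
        (≈-trans (enum x₀ (λ x → sumOver (λ v → f (x ∷ v)) (vecsOf xs k))
                   (λ x x≢x₀ → sum-zero (λ v → f (x ∷ v)) (vecsOf xs k)
                                  (λ v → off (x ∷ v) (λ e → x≢x₀ (cong head e)))))
                 (enumerates-vecs xs enum k v₀ (λ v → f (x₀ ∷ v))
                    (λ v v≢v₀ → off (x₀ ∷ v) (λ e → v≢v₀ (cong tail e))))))

  enumerates-states : ∀ n N → Enumerates (allStates n N)
  enumerates-states n N =
    enumerates-map (λ p → state (proj₁ p) (proj₂ p)) (λ s → hor s , ver s) (λ _ → refl) (λ _ → refl)
      (cartesianProduct rows columns) (enumerates-cartesian rows columns
        (enumerates-vecs (vecsOf spins (suc N)) (enumerates-vecs spins enumerates-spins (suc N)) n)
        (enumerates-vecs (vecsOf spins N) (enumerates-vecs spins enumerates-spins N) (suc n)))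
    where
    rows : List (Vec (Vec Spin (suc N)) n)
    rows = vecsOf (vecsOf spins (suc N)) n
    columns : List (Vec (Vec Spin N) (suc n))
    columns = vecsOf (vecsOf spins N) (suc n)

  prod-cong : ∀ m {f g : Fin m → Carrier} → (∀ i → f i ≈ g i) → prodF F m f ≈ prodF F m g
  prod-cong zero    f≈g = ≈-refl
  prod-cong (suc m) f≈g = *-cong (f≈g Fin.zero) (prod-cong m (λ i → f≈g (Fin.suc i)))

  prod-dichotomy : ∀ {p} m (f : Fin m → Carrier) (P : Fin m → Set p) →
                   (∀ i → f i ≈ 0# ⊎ P i) → prodF F m f ≈ 0# ⊎ (∀ i → P i)
  prod-dichotomy zero    f P cases = inj₂ λ ()
  prod-dichotomy (suc m) f P cases with cases Fin.zero
  ... | inj₁ f₀≈0 = inj₁ (≈-trans (*-congʳ f₀≈0) (zeroˡ _))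
  ... | inj₂ P₀ with prod-dichotomy m (λ i → f (Fin.suc i)) (λ i → P (Fin.suc i)) (λ i → cases (Fin.suc i))
  ...   | inj₁ rest≈0 = inj₁ (≈-trans (*-congˡ rest≈0) (zeroʳ _))
  ...   | inj₂ Ps     = inj₂ λ { Fin.zero → P₀ ; (Fin.suc i) → Ps i }

  prodℕ : ℕ → (ℕ → Carrier) → Carrier
  prodℕ zero    f = 1#
  prodℕ (suc m) f = prodℕ m f *F f m

  prod₁ : ℕ → (ℕ → Carrier) → Carrier
  prod₁ m f = prodℕ m (λ x → f (suc x))

  prodℕ-front : ∀ m f → prodℕ (suc m) f ≈ f 0 *F prodℕ m (λ x → f (suc x))
  prodℕ-front zero    f = ≈-trans (*-identityˡ _) (≈-sym (*-identityʳ _))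
  prodℕ-front (suc m) f = ≈-trans (*-congʳ (prodℕ-front m f)) (*-assoc _ _ _)

  prodF-prodℕ : ∀ m (f : ℕ → Carrier) → prodF F m (λ i → f (toℕ i)) ≈ prodℕ m f
  prodF-prodℕ zero    f = ≈-refl
  prodF-prodℕ (suc m) f = ≈-trans (*-congˡ (prodF-prodℕ m (λ x → f (suc x)))) (≈-sym (prodℕ-front m f))

  prodℕ-reverse : ∀ m f → prodℕ m (λ x → f (m ∸ suc x)) ≈ prodℕ m f
  prodℕ-reverse zero    f = ≈-refl
  prodℕ-reverse (suc m) f =
    ≈-trans (prodℕ-front m (λ x → f (suc m ∸ suc x))) (≈-trans (*-congˡ (prodℕ-reverse m f)) (*-comm _ _))

  reindex : ∀ {p} M L (Active : ℕ → Set p) (h f : ℕ → Carrier) (b : ℕ → ℕ) →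
    (∀ x → 1 ≤ x → x ≤ M → (Active x × h x ≈ f x) ⊎ (¬ Active x × h x ≈ 1#)) →
    (∀ j → b j < b (suc j)) →
    (∀ j → 1 ≤ j → j ≤ L → b j ≤ M × Active (b j)) →
    (∀ x → 1 ≤ x → x ≤ M → Active x → ∃[ j ] (1 ≤ j × j ≤ L × b j ≡ x)) →
    prod₁ M h ≈ prod₁ L (λ j → f (b j))
  reindex zero zero    Active h f b factors inc into onto = ≈-refl
  reindex zero (suc L) Active h f b factors inc into onto =
    contradiction (proj₁ (into (suc L) (s≤s z≤n) ≤-refl))
                  (<⇒≱ (≤-trans (s≤s z≤n) (increasing-≥ b inc (suc L))))
  reindex (suc M) L Active h f b factors inc into onto with factors (suc M) (s≤s z≤n) ≤-refl
  ... | inj₂ (inactive , h≈1) =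
    ≈-trans (*-cong (reindex M L Active h f b (λ x 1≤x x≤M → factors x 1≤x (m≤n⇒m≤1+n x≤M)) inc into′
                      (λ x 1≤x x≤M → onto x 1≤x (m≤n⇒m≤1+n x≤M))) h≈1)
            (*-identityʳ _)
    where
    into′ : ∀ j → 1 ≤ j → j ≤ L → b j ≤ M × Active (b j)
    into′ j 1≤j j≤L with into j 1≤j j≤L
    ... | bj≤1+M , active with m≤n⇒m<n∨m≡n bj≤1+M
    ...   | inj₁ bj<1+M = s≤s⁻¹ bj<1+M , active
    ...   | inj₂ bj≡1+M = contradiction (subst Active bj≡1+M active) inactive
  ... | inj₁ (active , h≈f) with onto (suc M) (s≤s z≤n) ≤-refl active
  ...   | j , 1≤j , j≤L , bj≡1+M with m≤n⇒m<n∨m≡n j≤L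
  ...     | inj₁ j<L = contradiction (proj₁ (into L (≤-trans 1≤j (<⇒≤ j<L)) ≤-refl))
                                     (<⇒≱ (subst (_< b L) bj≡1+M (increasing-strict b inc j<L)))
  ...     | inj₂ refl with j
  ...       | suc L′ =
    *-cong (reindex M L′ Active h f b (λ x 1≤x x≤M → factors x 1≤x (m≤n⇒m≤1+n x≤M)) inc into′ onto′)
           (≈-trans h≈f (≈-reflexive (cong f (sym bj≡1+M))))
    where
    -- b (L′ + 1) = M + 1 is the last active index
    below-last : ∀ {j} → j ≤ L′ → b j ≤ M
    below-last j≤L′ = s≤s⁻¹ (subst (b _ <_) bj≡1+M (increasing-strict b inc (s≤s j≤L′)))
    into′ : ∀ j → 1 ≤ j → j ≤ L′ → b j ≤ M × Active (b j)
    into′ j 1≤j j≤L′ = below-last j≤L′ , proj₂ (into j 1≤j (m≤n⇒m≤1+n j≤L′))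
    onto′ : ∀ x → 1 ≤ x → x ≤ M → Active x → ∃[ j ] (1 ≤ j × j ≤ L′ × b j ≡ x)
    onto′ x 1≤x x≤M active′ with onto x 1≤x (m≤n⇒m≤1+n x≤M) active′
    ... | j′ , 1≤j′ , j′≤1+L′ , bj′≡x with m≤n⇒m<n∨m≡n j′≤1+L′
    ...   | inj₁ j′<1+L′ = j′ , 1≤j′ , s≤s⁻¹ j′<1+L′ , bj′≡x
    ...   | inj₂ refl    = contradiction (subst (_≤ M) (trans (sym bj′≡x) bj≡1+M) x≤M) (<-irrefl refl)

  weight-zero-or-admissible : ∀ z a l t r b → vweight F z a l t r b ≡ 0# ⊎ Admissible l t r b
  weight-zero-or-admissible z a plus  plus  plus  plus  = inj₂ empty
  weight-zero-or-admissible z a minus minus minus minus = inj₂ crossing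
  weight-zero-or-admissible z a plus  minus plus  minus = inj₂ vertical
  weight-zero-or-admissible z a minus plus  minus plus  = inj₂ horizontal
  weight-zero-or-admissible z a minus plus  plus  minus = inj₂ turnDown
  weight-zero-or-admissible z a plus  minus minus plus  = inj₂ turnRight
  weight-zero-or-admissible z a plus  plus  plus  minus = inj₁ refl
  weight-zero-or-admissible z a plus  plus  minus plus  = inj₁ refl
  weight-zero-or-admissible z a plus  plus  minus minus = inj₁ refl
  weight-zero-or-admissible z a plus  minus plus  plus  = inj₁ refl
  weight-zero-or-admissible z a plus  minus minus minus = inj₁ refl
  weight-zero-or-admissible z a minus plus  plus  plus  = inj₁ refl
  weight-zero-or-admissible z a minus plus  minus minus = inj₁ refl
  weight-zero-or-admissible z a minus minus plus  plus  = inj₁ refl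
  weight-zero-or-admissible z a minus minus plus  minus = inj₁ refl
  weight-zero-or-admissible z a minus minus minus plus  = inj₁ refl

  horizontal-weight : ∀ x a → vweight F (- x) a minus plus minus plus ≈ x *F a ⁻¹ +F (- 1#)
  horizontal-weight x a = +-congʳ (≈-trans (-‿distribˡ-* (- x) (a ⁻¹)) (*-congʳ (-‿involutive x)))

  horizontal-vanishes : ∀ x → ¬ x ≈ 0# → x *F x ⁻¹ +F (- 1#) ≈ 0#
  horizontal-vanishes x x≉0 = ≈-trans (+-congʳ (⁻¹-inverse x x≉0)) (-‿inverseʳ 1#)

  vertex-dichotomy : ∀ {x} → ¬ x ≈ 0# → ∀ col c a → (col ≡ c → a ≡ x) → ∀ l t r b →
    vweight F (- x) a l t r b ≈ 0# ⊎ (Admissible l t r b × (col ≡ c → l ≡ minus → b ≡ plus → ⊥))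
  vertex-dichotomy {x} x≉0 col c a a≡x l t r b with weight-zero-or-admissible (- x) a l t r b
  ... | inj₁ w≡0       = inj₁ (≈-reflexive w≡0)
  ... | inj₂ empty     = inj₂ (empty , λ _ ())
  ... | inj₂ crossing  = inj₂ (crossing , λ _ _ ())
  ... | inj₂ vertical  = inj₂ (vertical , λ _ ())
  ... | inj₂ turnDown  = inj₂ (turnDown , λ _ _ ())
  ... | inj₂ turnRight = inj₂ (turnRight , λ _ ())
  ... | inj₂ horizontal with col ≟ c
  ...   | no  col≢c = inj₂ (horizontal , λ col≡c _ _ → col≢c col≡c)
  ...   | yes col≡c = inj₁ (≈-trans (horizontal-weight x a)
                               (≈-trans (+-congʳ (*-congˡ (≈-reflexive (cong _⁻¹ (a≡x col≡c)))))
                                        (horizontal-vanishes x x≉0)))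

∧-true : ∀ {x y} → x ∧ y ≡ true → x ≡ true × y ≡ true
∧-true {true} y≡true = refl , y≡true

true-∧ : ∀ {x y} → x ≡ true → y ≡ true → x ∧ y ≡ true
true-∧ refl refl = refl

allF-true : ∀ k {f} → allF k f ≡ true → ∀ i → f i ≡ true
allF-true (suc k) all Fin.zero    = proj₁ (∧-true all)
allF-true (suc k) all (Fin.suc i) = allF-true k (proj₂ (∧-true all)) i

true-allF : ∀ k {f} → (∀ i → f i ≡ true) → allF k f ≡ true
true-allF zero    all = refl
true-allF (suc k) all = true-∧ (all Fin.zero) (true-allF k (λ i → all (Fin.suc i)))

==ˢ-true : ∀ {x y} → (x ==ˢ y) ≡ true → x ≡ y
==ˢ-true {plus}  {plus}  _ = refl
==ˢ-true {minus} {minus} _ = refl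

true-==ˢ : ∀ {x y} → x ≡ y → (x ==ˢ y) ≡ true
true-==ˢ {plus}  refl = refl
true-==ˢ {minus} refl = refl

at-fin : ∀ {p} {k} (P : ℕ → Set p) → (∀ (i : Fin k) → P (toℕ i)) → ∀ i → i < k → P i
at-fin P all i i<k = subst P (toℕ-fromℕ< i<k) (all (fromℕ< i<k))

spinOf : ∀ {p} {P : Set p} → Dec P → Spin
spinOf P? = if ⌊ P? ⌋ then minus else plus

spinOf-yes : ∀ {p} {P : Set p} (P? : Dec P) → P → spinOf P? ≡ minus
spinOf-yes (yes _)  _ = refl
spinOf-yes (no ¬p) p = contradiction p ¬p

spinOf-no : ∀ {p} {P : Set p} (P? : Dec P) → ¬ P → spinOf P? ≡ plus
spinOf-no (yes p) ¬p = contradiction p ¬p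
spinOf-no (no _)  _  = refl

spinOf-minus : ∀ {p} {P : Set p} (P? : Dec P) → spinOf P? ≡ minus → P
spinOf-minus (yes p) _ = p

spinOf-⇔ : ∀ {p q} {P : Set p} {Q : Set q} (P? : Dec P) (Q? : Dec Q) → (P → Q) → (Q → P) → spinOf P? ≡ spinOf Q?
spinOf-⇔ (yes _) (yes _) _   _   = refl
spinOf-⇔ (no  _) (no  _) _   _   = refl
spinOf-⇔ (yes p) (no ¬q) p→q _   = contradiction (p→q p) ¬q
spinOf-⇔ (no ¬p) (yes q) _   q→p = contradiction (q→p q) ¬p

entry₂ : ∀ {A : Set} {m k} → Vec (Vec A k) m → ℕ → ℕ → A → A
entry₂ xss i j d = entry (entry xss i (replicate _ d)) j d

entry₂-lookup : ∀ {A : Set} {m k} (xss : Vec (Vec A k) m) I J d →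
                entry₂ xss (toℕ I) (toℕ J) d ≡ lookup (lookup xss I) J
entry₂-lookup xss I J d rewrite entry-lookup xss I (replicate _ d) = entry-lookup (lookup xss I) J d

grid : ∀ {A : Set} m k → (ℕ → ℕ → A) → Vec (Vec A k) m
grid m k f = tabulate (λ I → tabulate (λ J → f (toℕ I) (toℕ J)))

lookup-grid : ∀ {A : Set} {m k} (f : ℕ → ℕ → A) I J → lookup (lookup (grid m k f) I) J ≡ f (toℕ I) (toℕ J)
lookup-grid f I J = trans (cong (λ row → lookup row J) (lookup∘tabulate _ I)) (lookup∘tabulate _ J)

grid-unique : ∀ {A : Set} {m k} (xss : Vec (Vec A k) m) (f : ℕ → ℕ → A) d →
              (∀ i j → i < m → j < k → entry₂ xss i j d ≡ f i j) → xss ≡ grid m k f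
grid-unique xss f d agree = trans (sym (tabulate∘lookup xss)) (tabulate-cong λ I →
  trans (sym (tabulate∘lookup (lookup xss I))) (tabulate-cong λ J →
    trans (sym (entry₂-lookup xss I J d)) (agree (toℕ I) (toℕ J) (toℕ<n I) (toℕ<n J))))

grid-entry : ∀ {A : Set} {m k} (f : ℕ → ℕ → A) i j d → i < m → j < k → entry₂ (grid m k f) i j d ≡ f i j
grid-entry {m = m} {k} f i j d i<m j<k =
  subst₂ (λ i′ j′ → entry₂ (grid m k f) i′ j′ d ≡ f i′ j′) (toℕ-fromℕ< i<m) (toℕ-fromℕ< j<k)
    (trans (entry₂-lookup (grid m k f) (fromℕ< i<m) (fromℕ< j<k) d) (lookup-grid f (fromℕ< i<m) (fromℕ< j<k)))

-- ℕ-indexed view of the spins of a state: H s i k is the horizontal edge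
-- left of position k in row i, V s l k the vertical edge at level l above
-- position k.
module _ {n N : ℕ} where
  H : State n N → ℕ → ℕ → Spin
  H s i k = entry₂ (hor s) i k plus

  V : State n N → ℕ → ℕ → Spin
  V s l k = entry₂ (ver s) l k plus

  -- All vertices of s are admissible and row i has no horizontal vertex in
  -- column c i: the states whose weight can survive z_i = -α_{c i}.
  UnblockedAt : (ℕ → ℕ) → State n N → ℕ → ℕ → Set
  UnblockedAt c s i k = Admissible (H s i k) (V s i k) (H s i (suc k)) (V s (suc i) k)
                      × (N ∸ k ≡ c i → H s i k ≡ minus → V s (suc i) k ≡ plus → ⊥)

  Unblocked : (ℕ → ℕ) → State n N → Set
  Unblocked c s = ∀ i k → i < n → k < N → UnblockedAt c s i k

module Weights {c ℓ} (F : Field c ℓ) (α : ℕ → Field.Carrier F) {n N : ℕ} where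
  open Field F renaming (refl to ≈-refl; sym to ≈-sym; trans to ≈-trans; reflexive to ≈-reflexive)
  open FieldFacts F

  vertexWeight : Carrier → State n N → ℕ → ℕ → Carrier
  vertexWeight z s i k = vweight F z (α (N ∸ k)) (H s i k) (V s i k) (H s i (suc k)) (V s (suc i) k)

  stateWeight-view : ∀ z s →
    stateWeight F z α s ≈ prodF F n (λ I → prodF F N (λ K → vertexWeight (z I) s (toℕ I) (toℕ K)))
  stateWeight-view z s = prod-cong n λ I → prod-cong N λ K → ≈-reflexive (vertex-view I K)
    where
    vertex-view : ∀ I K →
      vweight F (z I) (α (N ∸ toℕ K)) (lookup (lookup (hor s) I) (inject₁ K)) (lookup (lookup (ver s) (inject₁ I)) K)
                                      (lookup (lookup (hor s) I) (Fin.suc K)) (lookup (lookup (ver s) (Fin.suc I)) K)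
      ≡ vertexWeight (z I) s (toℕ I) (toℕ K)
    vertex-view I K
      rewrite sym (entry₂-lookup (hor s) I (inject₁ K) plus) | sym (entry₂-lookup (ver s) (inject₁ I) K plus)
            | sym (entry₂-lookup (hor s) I (Fin.suc K) plus) | sym (entry₂-lookup (ver s) (Fin.suc I) K plus)
            | toℕ-inject₁ K | toℕ-inject₁ I = refl

  weight-zero-or-unblocked : ∀ (cols : ℕ → ℕ) (z : Fin n → Carrier) → (∀ I → z I ≡ - α (cols (toℕ I))) →
    (∀ i → i < n → ¬ α (cols i) ≈ 0#) → ∀ s → stateWeight F z α s ≈ 0# ⊎ Unblocked cols s
  weight-zero-or-unblocked cols z z≡ α≉0 s with prod-dichotomy n _ _ (λ I → prod-dichotomy N _ _ (λ K → vertex I K))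
    where
    vertex : ∀ I K → vertexWeight (z I) s (toℕ I) (toℕ K) ≈ 0# ⊎ UnblockedAt cols s (toℕ I) (toℕ K)
    vertex I K rewrite z≡ I =
      vertex-dichotomy (α≉0 (toℕ I) (toℕ<n I)) (N ∸ toℕ K) (cols (toℕ I)) (α (N ∸ toℕ K)) (cong α)
        (H s (toℕ I) (toℕ K)) (V s (toℕ I) (toℕ K)) (H s (toℕ I) (suc (toℕ K))) (V s (suc (toℕ I)) (toℕ K))
  ... | inj₁ vanishes  = inj₁ (≈-trans (stateWeight-view z s) vanishes)
  ... | inj₂ good      = inj₂ λ i k i<n k<N →
    at-fin (UnblockedAt cols s i) (at-fin (λ i → ∀ K → UnblockedAt cols s i (toℕ K)) good i i<n) k k<N

module Setting {n} (la : Vec ℕ n) (la-partition : IsPartition la) where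
  open Partition la la-partition public

  N : ℕ
  N = n + first la

  pos : ℕ → ℕ
  pos m = N ∸ col m

  pos-strict : ∀ {m m′} → m < m′ → m′ ≤ n → pos m < pos m′
  pos-strict {m} m<m′ m′≤n = ∸-monoʳ-< (col-strict m<m′ m′≤n) (col≤ m)

  pos-mono : ∀ {m m′} → m ≤ m′ → pos m ≤ pos m′
  pos-mono m≤m′ = ∸-monoʳ-≤ N (col-antitone m≤m′)

  pos<N : ∀ {m} → m < n → pos m < N
  pos<N {m} m<n = ∸-monoʳ-< {o = 0} (col-positive m<n) (col≤ m)

  pos-last : pos n ≡ N
  pos-last = cong (N ∸_) (col-beyond ≤-refl)

  col-pos : ∀ m → N ∸ pos m ≡ col m
  col-pos m = m∸[m∸n]≡n (col≤ m)

  -- The diagonal configuration: the path entering at the top of column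
  -- col m runs down to row m, turns right there and leaves at the right
  -- boundary.
  PathAt : ℕ → ℕ → Set
  PathAt l k = ∃[ m ] (m < n × (l ≤ m × k ≡ pos m))

  path? : ∀ l k → Dec (PathAt l k)
  path? l k = anyUpTo? (λ m → l ≤? m ×-dec k ≟ pos m) n

  diagV : ℕ → ℕ → Spin
  diagV l k = spinOf (path? l k)

  diagH : ℕ → ℕ → Spin
  diagH i k = spinOf (pos i <? k)

  diagonal : State n N
  diagonal = state (grid n (suc N) diagH) (grid (suc n) N diagV)

  diagV-path : ∀ {l m} → l ≤ m → m < n → diagV l (pos m) ≡ minus
  diagV-path l≤m m<n = spinOf-yes (path? _ _) (_ , m<n , l≤m , refl)

  diagV-path⁻¹ : ∀ {l k} → diagV l k ≡ minus → PathAt l k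
  diagV-path⁻¹ = spinOf-minus (path? _ _)

  diagV-left : ∀ {i l k} → i ≤ l → k < pos i → diagV l k ≡ plus
  diagV-left i≤l k<pos = spinOf-no (path? _ _) λ (m , m<n , l≤m , k≡) →
    <-irrefl k≡ (<-≤-trans k<pos (pos-mono (≤-trans i≤l l≤m)))

  diagV-turn : ∀ {i} → diagV (suc i) (pos i) ≡ plus
  diagV-turn = spinOf-no (path? _ _) λ (m , m<n , i<m , e) → <-irrefl e (pos-strict i<m (<⇒≤ m<n))

  diagV-pass : ∀ {i k} → k ≢ pos i → diagV (suc i) k ≡ diagV i k
  diagV-pass {i} {k} k≢pos = spinOf-⇔ (path? _ _) (path? _ _)
    (λ (m , m<n , i<m , e) → m , m<n , <⇒≤ i<m , e)
    (λ (m , m<n , i≤m , e) → m , m<n , ≤∧≢⇒< i≤m (λ i≡m → k≢pos (subst (λ x → k ≡ pos x) (sym i≡m) e)) , e)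

  diagV-bottom : ∀ {k} → diagV n k ≡ plus
  diagV-bottom = spinOf-no (path? _ _) λ (m , m<n , n≤m , _) → <⇒≱ m<n n≤m

  diagH-left : ∀ {i k} → k ≤ pos i → diagH i k ≡ plus
  diagH-left k≤pos = spinOf-no (_ <? _) (≤⇒≯ k≤pos)

  diagH-right : ∀ {i k} → pos i < k → diagH i k ≡ minus
  diagH-right pos<k = spinOf-yes (_ <? _) pos<k

  diagonal-left : ∀ i {k} → k < pos i →
    diagH i k ≡ plus × diagV i k ≡ plus × diagH i (suc k) ≡ plus × diagV (suc i) k ≡ plus
  diagonal-left i {k} k<pos = diagH-left {i} (<⇒≤ k<pos) , diagV-left {i} ≤-refl k<pos
                            , diagH-left {i} k<pos , diagV-left {i} (n≤1+n i) k<pos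

  diagonal-turn : ∀ i → i < n →
    diagH i (pos i) ≡ plus × diagV i (pos i) ≡ minus × diagH i (suc (pos i)) ≡ minus × diagV (suc i) (pos i) ≡ plus
  diagonal-turn i i<n = diagH-left {i} ≤-refl , diagV-path ≤-refl i<n , diagH-right {i} ≤-refl , diagV-turn {i}

  diagonal-right : ∀ i {k} → pos i < k →
    diagH i k ≡ minus × diagH i (suc k) ≡ minus × diagV (suc i) k ≡ diagV i k
  diagonal-right i pos<k = diagH-right {i} pos<k , diagH-right {i} (m<n⇒m<1+n pos<k)
                         , diagV-pass {i} (λ e → <-irrefl (sym e) pos<k)

  diagonal-admissible : ∀ i k → i < n →
    Admissible (diagH i k) (diagV i k) (diagH i (suc k)) (diagV (suc i) k)
  diagonal-admissible i k i<n with <-cmp k (pos i)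
  ... | tri< k<pos _ _ with diagonal-left i k<pos
  ...   | l , t , r , b rewrite l | t | r | b = empty
  diagonal-admissible i k i<n | tri≈ _ refl _ with diagonal-turn i i<n
  ...   | l , t , r , b rewrite l | t | r | b = turnRight
  diagonal-admissible i k i<n | tri> _ _ pos<k with diagonal-right i pos<k
  ...   | l , r , b rewrite l | r | b with diagV i k
  ...     | plus  = horizontal
  ...     | minus = crossing

  Valid : State n N → Set
  Valid s = validB la s ≡ true

  record Boundary (s : State n N) : Set where
    field
      left   : ∀ i → i < n → H s i 0 ≡ plus
      right  : ∀ i → i < n → H s i N ≡ minus
      bottom : ∀ k → k < N → V s n k ≡ plus
      top    : ∀ k → k < N → V s 0 k ≡ diagV 0 k

  top-diagonal : ∀ k → k < N → topSpin la (N ∸ k) ≡ diagV 0 k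
  top-diagonal k k<N = spinOf-⇔ (any? _) (path? 0 k)
    (λ (I , e) → toℕ I , toℕ<n I , z≤n ,
       trans (sym (m∸[m∸n]≡n (<⇒≤ k<N))) (cong (N ∸_) (trans e (sym (col-lookup I)))))
    (λ (m , m<n , _ , e) → fromℕ< m<n ,
       trans (cong (N ∸_) e) (trans (col-pos m)
         (trans (cong col (sym (toℕ-fromℕ< m<n))) (col-lookup (fromℕ< m<n)))))

  valid-boundary : ∀ {s} → Valid s → Boundary s
  valid-boundary {s} valid = record
    { left   = at-fin (λ i → H s i 0 ≡ plus) λ I →
        trans (entry₂-lookup (hor s) I Fin.zero plus) (==ˢ-true (proj₁ (∧-true (row-tests I))))
    ; right  = at-fin (λ i → H s i N ≡ minus) λ I →
        trans (cong (H s (toℕ I)) (sym (toℕ-fromℕ N)))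
              (trans (entry₂-lookup (hor s) I (fromℕ N) plus) (==ˢ-true (proj₂ (∧-true (row-tests I)))))
    ; bottom = at-fin (λ k → V s n k ≡ plus) λ K →
        trans (cong (λ l → V s l (toℕ K)) (sym (toℕ-fromℕ n)))
              (trans (entry₂-lookup (ver s) (fromℕ n) K plus) (==ˢ-true (proj₁ (∧-true (column-tests K)))))
    ; top    = at-fin (λ k → V s 0 k ≡ diagV 0 k) λ K →
        trans (entry₂-lookup (ver s) Fin.zero K plus)
              (trans (==ˢ-true (proj₂ (∧-true (column-tests K)))) (top-diagonal (toℕ K) (toℕ<n K)))
    }
    where
    row-tests : ∀ I → ((lookup (lookup (hor s) I) Fin.zero ==ˢ plus)
                       ∧ (lookup (lookup (hor s) I) (fromℕ N) ==ˢ minus)) ≡ true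
    row-tests = allF-true n (proj₁ (∧-true valid))
    column-tests : ∀ K → ((lookup (lookup (ver s) (fromℕ n)) K ==ˢ plus)
                     ∧ (lookup (lookup (ver s) Fin.zero) K ==ˢ topSpin la (N ∸ toℕ K))) ≡ true
    column-tests = allF-true N (proj₂ (∧-true {allF n _} valid))

  boundary-valid : ∀ {s} → Boundary s → Valid s
  boundary-valid {s} b = true-∧ (true-allF n row-test) (true-allF N column-test)
    where
    open Boundary b
    row-test : ∀ I → ((lookup (lookup (hor s) I) Fin.zero ==ˢ plus)
                      ∧ (lookup (lookup (hor s) I) (fromℕ N) ==ˢ minus)) ≡ true
    row-test I = true-∧ (true-==ˢ (trans (sym (entry₂-lookup (hor s) I Fin.zero plus)) (left (toℕ I) (toℕ<n I))))
                   (true-==ˢ (trans (sym (entry₂-lookup (hor s) I (fromℕ N) plus))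
                                    (trans (cong (H s (toℕ I)) (toℕ-fromℕ N)) (right (toℕ I) (toℕ<n I)))))
    column-test : ∀ K → ((lookup (lookup (ver s) (fromℕ n)) K ==ˢ plus)
                         ∧ (lookup (lookup (ver s) Fin.zero) K ==ˢ topSpin la (N ∸ toℕ K))) ≡ true
    column-test K = true-∧ (true-==ˢ (trans (sym (entry₂-lookup (ver s) (fromℕ n) K plus))
                                       (trans (cong (λ l → V s l (toℕ K)) (toℕ-fromℕ n)) (bottom (toℕ K) (toℕ<n K)))))
                      (true-==ˢ (trans (sym (entry₂-lookup (ver s) Fin.zero K plus))
                                       (trans (top (toℕ K) (toℕ<n K)) (sym (top-diagonal (toℕ K) (toℕ<n K))))))

  H-diagonal : ∀ i k → i < n → k ≤ N → H diagonal i k ≡ diagH i k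
  H-diagonal i k i<n k≤N = grid-entry diagH i k plus i<n (s≤s k≤N)

  V-diagonal : ∀ l k → l ≤ n → k < N → V diagonal l k ≡ diagV l k
  V-diagonal l k l≤n k<N = grid-entry diagV l k plus (s≤s l≤n) k<N

  diagonal-valid : Valid diagonal
  diagonal-valid = boundary-valid {diagonal} record
    { left   = λ i i<n → trans (H-diagonal i 0 i<n z≤n) (diagH-left {i} z≤n)
    ; right  = λ i i<n → trans (H-diagonal i N i<n ≤-refl) (diagH-right {i} (pos<N i<n))
    ; bottom = λ k k<N → trans (V-diagonal n k ≤-refl k<N) (diagV-bottom {k})
    ; top    = λ k k<N → V-diagonal 0 k z≤n k<N
    }

  module Paths (c : ℕ → ℕ) (c-decreasing : ∀ m → m < n → c (suc m) < c m)
               (s : State n N) (boundary : Boundary s) (unblocked : Unblocked c s) where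
    open Boundary boundary
    open PathBound n N (H s) (V s) c (λ i k i<n k<N → proj₁ (unblocked i k i<n k<N)) left bottom
                   c-decreasing (λ i k i<n k<N → proj₂ (unblocked i k i<n k<N)) public

    top-paths : ∀ m k → m < n → pos m < k → suc m ≤ paths (V s 0) k
    top-paths m k m<n pos<k =
      paths-lower (V s 0) pos 0 m k z≤n
        (λ j _ j≤m → trans (top (pos j) (pos<N (≤-<-trans j≤m m<n))) (diagV-path z≤n (≤-<-trans j≤m m<n)))
        (λ j _ j<m → pos-strict (n<1+n j) (≤-trans j<m (<⇒≤ m<n))) pos<k

  module Uniqueness (s : State n N) (boundary : Boundary s) (unblocked : Unblocked col s) where
    open Boundary boundary
    open Paths col (λ m m<n → col-strict (n<1+n m) m<n) s boundary unblocked

    module Row (i : ℕ) (i<n : i < n) (enter : ∀ k → k < N → V s i k ≡ diagV i k) where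

      H-left : ∀ k → k ≤ pos i → H s i k ≡ plus
      H-left k k≤pos = unoccupied (m+n≡0⇒n≡0 (paths (V s (suc i)) k) (begin
          paths (V s (suc i)) k + occupancy (H s i k) ≡⟨ row-paths i i<n k k≤N ⟨
          paths (V s i) k                             ≡⟨ paths-none (V s i) k none ⟩
          0                                           ∎))
        where
        open ≡-Reasoning
        k≤N : k ≤ N
        k≤N = ≤-trans k≤pos (m∸n≤m N (col i))
        none : ∀ k′ → k′ < k → V s i k′ ≡ plus
        none k′ k′<k = trans (enter k′ (<-≤-trans k′<k k≤N)) (diagV-left {i} ≤-refl (<-≤-trans k′<k k≤pos))

      -- right of pos i, the m - i + 1 paths of rows i, …, m entering left
      -- of k cannot all leave through the bottom (at most m - i can)
      H-right : ∀ k → pos i < k → k ≤ N → H s i k ≡ minus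
      H-right k pos<k k≤N with bracket pos n (<⇒≤ i<n) pos<k (subst (k ≤_) (sym pos-last) k≤N)
      ... | m , i≤m , m<n , posm<k , k≤pos1+m = occupied (+-cancelˡ-≤ (m ∸ i) 1 _ (begin
          m ∸ i + 1                                   ≡⟨ ℕₚ.+-comm (m ∸ i) 1 ⟩
          suc (m ∸ i)                                 ≤⟨ entering ⟩
          paths (V s i) k                             ≡⟨ row-paths i i<n k k≤N ⟩
          paths (V s (suc i)) k + occupancy (H s i k) ≤⟨ +-monoˡ-≤ _ leaving ⟩
          m ∸ i + occupancy (H s i k)                 ∎))
        where
        open ≤-Reasoning
        entering : suc (m ∸ i) ≤ paths (V s i) k
        entering = paths-lower (V s i) pos i m k i≤m
          (λ j i≤j j≤m → trans (enter (pos j) (pos<N (≤-<-trans j≤m m<n))) (diagV-path i≤j (≤-<-trans j≤m m<n)))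
          (λ j _ j<m → pos-strict (n<1+n j) (≤-trans j<m (<⇒≤ m<n))) posm<k
        leaving : paths (V s (suc i)) k ≤ m ∸ i
        leaving = ≤-trans (paths-mono (V s (suc i)) k≤pos1+m) (paths-below (suc i) i<n (suc m) (s≤s i≤m))

      H-agrees : ∀ k → k ≤ N → H s i k ≡ diagH i k
      H-agrees k k≤N with <-≤-connex (pos i) k
      ... | inj₁ pos<k = trans (H-right k pos<k k≤N) (sym (diagH-right {i} pos<k))
      ... | inj₂ k≤pos = trans (H-left k k≤pos) (sym (diagH-left {i} k≤pos))

      -- the bottom spins are forced by admissibility
      leave : ∀ k → k < N → V s (suc i) k ≡ diagV (suc i) k
      leave k k<N = bottom-unique admissible (diagonal-admissible i k i<n)
        where
        admissible : Admissible (diagH i k) (diagV i k) (diagH i (suc k)) (V s (suc i) k)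
        admissible = subst₂ (λ l r → Admissible l (diagV i k) r (V s (suc i) k))
                       (H-agrees k (<⇒≤ k<N)) (H-agrees (suc k) k<N)
                       (subst (λ t → Admissible (H s i k) t (H s i (suc k)) (V s (suc i) k)) (enter k k<N)
                          (proj₁ (unblocked i k i<n k<N)))

    V-agrees : ∀ l → l ≤ n → ∀ k → k < N → V s l k ≡ diagV l k
    V-agrees zero    _     = top
    V-agrees (suc l) 1+l≤n = Row.leave l 1+l≤n (V-agrees l (<⇒≤ 1+l≤n))

    unique : s ≡ diagonal
    unique = cong₂ state
      (grid-unique (hor s) diagH plus λ i k i<n k≤N →
         Row.H-agrees i i<n (V-agrees i (<⇒≤ i<n)) k (s≤s⁻¹ k≤N))
      (grid-unique (ver s) diagV plus λ l k l≤n k<N → V-agrees l (s≤s⁻¹ l≤n) k k<N)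

  -- A state with the boundary of λ that is unblocked at the columns of μ
  -- forces λ ⊆ μ: if λ_{m+1} > μ_{m+1}, the m + 1 top paths left of column
  -- μ_{m+1} + n - m exceed the bound m.
  unblocked-contained : ∀ mu (mu-partition : IsPartition mu) s →
    Boundary s → Unblocked (Partition.col mu mu-partition) s → la ⊆ₚ mu
  unblocked-contained mu mu-partition s boundary unblocked I with row (toℕ I) ≤? Partition.row mu mu-partition (toℕ I)
  ... | yes ≤row = subst₂ _≤_ (entry-lookup la I 0) (entry-lookup mu I 0) ≤row
  ... | no  ≰row = contradiction (paths-below 0 z≤n m z≤n) (<⇒≱ (top-paths m (N ∸ M.col m) (toℕ<n I) pos<))
    where
    module M = Partition mu mu-partition
    open Paths M.col (λ m m<n → M.col-strict (n<1+n m) m<n) s boundary unblocked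
    m : ℕ
    m = toℕ I
    pos< : pos m < N ∸ M.col m
    pos< = ∸-monoʳ-< (∸-monoˡ-< (+-monoˡ-< n (≰⇒> ≰row)) (≤-trans (<⇒≤ (toℕ<n I)) (m≤n+m n (M.row m))))
                     (col≤ m)

module Evaluation {c ℓ} (F : Field c ℓ) (α : ℕ → Field.Carrier F)
                  (α≉0 : ∀ k → ¬ Field._≈_ F (α (suc k)) (Field.0# F))
                  {n} (la : Vec ℕ n) (la-partition : IsPartition la) where
  open Field F renaming (_+_ to _+F_; _*_ to _*F_; refl to ≈-refl; sym to ≈-sym; trans to ≈-trans; reflexive to ≈-reflexive)
  open FieldFacts F
  open Setting la la-partition
  open Weights F α {n} {N}

  α-col≉0 : ∀ ν (ν-partition : IsPartition ν) → ∀ i → i < n → ¬ α (Partition.col ν ν-partition i) ≈ 0#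
  α-col≉0 ν ν-partition i i<n with Partition.col ν ν-partition i | Partition.col-positive ν ν-partition i<n
  ... | zero  | ()
  ... | suc k | _ = α≉0 k

  zAt-col : ∀ ν (ν-partition : IsPartition ν) → ∀ I → zAt F α n ν I ≡ - α (Partition.col ν ν-partition (toℕ I))
  zAt-col ν ν-partition I = cong (λ x → - α x) (sym (Partition.col-lookup ν ν-partition I))

  valid? : ∀ (s : State n N) → Dec (Valid s)
  valid? s = validB la s ≟ᵇ true

  Z-sum : ∀ z → Z F n la z α ≈ sumOver (restrict valid? (stateWeight F z α)) (allStates n N)
  Z-sum z = sum-filter valid? (stateWeight F z α) (allStates n N)

  vanishing : ∀ mu → IsPartition mu → ¬ (la ⊆ₚ mu) → Z F n la (zAt F α n mu) α ≈ 0#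
  vanishing mu mu-partition ¬la⊆mu = ≈-trans (Z-sum (zAt F α n mu)) (sum-zero _ (allStates n N) each)
    where
    each : ∀ s → restrict valid? (stateWeight F (zAt F α n mu) α) s ≈ 0#
    each s with valid? s
    ... | no  _     = ≈-refl
    ... | yes valid with weight-zero-or-unblocked (Partition.col mu mu-partition) (zAt F α n mu)
                           (zAt-col mu mu-partition) (α-col≉0 mu mu-partition) s
    ...   | inj₁ w≈0       = w≈0
    ...   | inj₂ unblocked = ⊥-elim (¬la⊆mu (unblocked-contained mu mu-partition s (valid-boundary valid) unblocked))

  diagWeight : ℕ → ℕ → Carrier
  diagWeight i k = vweight F (- α (col i)) (α (N ∸ k)) (diagH i k) (diagV i k) (diagH i (suc k)) (diagV (suc i) k)

  boxFactor : ℕ → ℕ → Carrier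
  boxFactor i x = α (col i) *F α x ⁻¹ +F (- 1#)

  diagonal-column : ∀ i x → i < n → x ≤ N →
    (Gap i x × diagWeight i (N ∸ x) ≈ boxFactor i x) ⊎ (¬ Gap i x × diagWeight i (N ∸ x) ≈ 1#)
  diagonal-column i x i<n x≤N with <-cmp x (col i)
  ... | tri≈ _ refl _ with diagonal-turn i i<n
  ...   | l , t , r , b rewrite l | t | r | b = inj₂ ((λ (x<x , _) → <-irrefl refl x<x) , ≈-refl)
  diagonal-column i x i<n x≤N | tri> _ _ col<x with diagonal-left i (∸-monoʳ-< col<x x≤N)
  ...   | l , t , r , b rewrite l | t | r | b = inj₂ ((λ (x<col , _) → <-asym x<col col<x) , ≈-refl)
  diagonal-column i x i<n x≤N | tri< x<col _ _ with diagonal-right i (∸-monoʳ-< x<col (col≤ i))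
  ...   | l , r , b rewrite l | r | b with diagV i (N ∸ x) in through
  ...     | plus  = inj₁ ((x<col , unoccupied-column) , horizontal-column)
    where
    unoccupied-column : ∀ m → i ≤ m → m < n → x ≢ col m
    unoccupied-column m i≤m m<n refl = contradiction (trans (sym through) (diagV-path i≤m m<n)) λ ()
    horizontal-column : vweight F (- α (col i)) (α (N ∸ (N ∸ x))) minus plus minus plus ≈ boxFactor i x
    horizontal-column = ≈-trans (horizontal-weight (α (col i)) _)
                          (≈-reflexive (cong (λ y → α (col i) *F α y ⁻¹ +F (- 1#)) (m∸[m∸n]≡n x≤N)))
  ...     | minus = inj₂ (occupied-column , ≈-refl)
    where
    occupied-column : ¬ Gap i x
    occupied-column (_ , distinct) with diagV-path⁻¹ through
    ... | m , m<n , i≤m , e = distinct m i≤m m<n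
          (trans (sym (m∸[m∸n]≡n x≤N)) (trans (cong (N ∸_) e) (col-pos m)))

  diagonal-row : ∀ i → i < n →
    prodℕ N (diagWeight i) ≈ prod₁ (row i) (λ j → boxFactor i (gap j))
  diagonal-row i i<n = ≈-trans (≈-sym (prodℕ-reverse N (diagWeight i)))
    (reindex N (row i) (Gap i) (λ x → diagWeight i (N ∸ x)) (boxFactor i) gap
       (λ x _ x≤N → diagonal-column i x i<n x≤N)
       gap-increasing
       (λ j 1≤j j≤row → let g = gap-Gap 1≤j j≤row in ≤-trans (<⇒≤ (proj₁ g)) (col≤ i) , g)
       (λ x 1≤x _ g → Gap-gap 1≤x g))

  diagonal-vertex : ∀ I k → k < N → vertexWeight (zAt F α n la I) diagonal (toℕ I) k ≡ diagWeight (toℕ I) k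
  diagonal-vertex I k k<N
    rewrite zAt-col la la-partition I
          | H-diagonal (toℕ I) k (toℕ<n I) (<⇒≤ k<N) | H-diagonal (toℕ I) (suc k) (toℕ<n I) k<N
          | V-diagonal (toℕ I) k (<⇒≤ (toℕ<n I)) k<N | V-diagonal (suc (toℕ I)) k (toℕ<n I) k<N = refl

  box-row : ∀ I → prodF F (row (toℕ I)) (λ J → boxFactor (toℕ I) (gap (suc (toℕ J))))
    ≡ prodF F (lookup la I) (λ J → (α (n ∸ toℕ I + lookup la I)
                                    *F (α (n ∸ conj la (suc (toℕ J)) + suc (toℕ J)) ⁻¹)) +F (- 1#))
  box-row I rewrite entry-lookup la I 0
                  | ℕₚ.+-∸-assoc (lookup la I) (<⇒≤ (toℕ<n I)) | ℕₚ.+-comm (lookup la I) (n ∸ toℕ I) = refl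

  diagonal-weight : stateWeight F (zAt F α n la) α diagonal ≈ boxProduct F α n la
  diagonal-weight = ≈-trans (stateWeight-view (zAt F α n la) diagonal) (prod-cong n row-I)
    where
    row-I : ∀ I → prodF F N (λ K → vertexWeight (zAt F α n la I) diagonal (toℕ I) (toℕ K))
                ≈ prodF F (lookup la I) (λ J → (α (n ∸ toℕ I + lookup la I)
                                    *F (α (n ∸ conj la (suc (toℕ J)) + suc (toℕ J)) ⁻¹)) +F (- 1#))
    row-I I = begin
      prodF F N (λ K → vertexWeight (zAt F α n la I) diagonal i (toℕ K))
        ≈⟨ prod-cong N (λ K → ≈-reflexive (diagonal-vertex I (toℕ K) (toℕ<n K))) ⟩
      prodF F N (λ K → diagWeight i (toℕ K))                   ≈⟨ prodF-prodℕ N (diagWeight i) ⟩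
      prodℕ N (diagWeight i)                                   ≈⟨ diagonal-row i (toℕ<n I) ⟩
      prod₁ (row i) (λ j → boxFactor i (gap j))
        ≈⟨ prodF-prodℕ (row i) (λ j → boxFactor i (gap (suc j))) ⟨
      prodF F (row i) (λ J → boxFactor i (gap (suc (toℕ J)))) ≡⟨ box-row I ⟩
      prodF F (lookup la I) (λ J → (α (n ∸ i + lookup la I)
                                    *F (α (n ∸ conj la (suc (toℕ J)) + suc (toℕ J)) ⁻¹)) +F (- 1#)) ∎
      where
      open ≈-Reasoning (Field.setoid F)
      i : ℕ
      i = toℕ I

  diagonal-evaluation : Z F n la (zAt F α n la) α ≈ boxProduct F α n la
  diagonal-evaluation =
    ≈-trans (Z-sum z) (≈-trans (enumerates-states n N diagonal w off) (≈-trans at-diagonal diagonal-weight))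
    where
    z : Fin n → Carrier
    z = zAt F α n la
    w : State n N → Carrier
    w = restrict valid? (stateWeight F z α)
    off : ∀ s → s ≢ diagonal → w s ≈ 0#
    off s s≢diagonal with valid? s
    ... | no  _     = ≈-refl
    ... | yes valid with weight-zero-or-unblocked col z (zAt-col la la-partition) (α-col≉0 la la-partition) s
    ...   | inj₁ w≈0       = w≈0
    ...   | inj₂ unblocked = ⊥-elim (s≢diagonal (Uniqueness.unique s (valid-boundary valid) unblocked))
    at-diagonal : w diagonal ≈ stateWeight F z α diagonal
    at-diagonal with valid? diagonal
    ... | yes _       = ≈-refl
    ... | no  invalid = ⊥-elim (invalid diagonal-valid)

mainTheorem9 : ∀ {c ℓ} (F : Field c ℓ) (α : ℕ → Field.Carrier F) →
    (∀ k → ¬ (Field._≈_ F (α (suc k)) (Field.0# F))) →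
    (n : ℕ) → 1 ≤ n → (la mu : Vec ℕ n) → IsPartition la → IsPartition mu →
    ((¬ (la ⊆ₚ mu) → Field._≈_ F (Z F n la (zAt F α n mu) α) (Field.0# F))
     × Field._≈_ F (Z F n la (zAt F α n la) α) (boxProduct F α n la))
mainTheorem9 F α α≉0 n _ la mu la-partition mu-partition =
  vanishing mu mu-partition , diagonal-evaluation
  where open Evaluation F α α≉0 la la-partition
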